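{- The set $\{(1^n,1^m,1^l)\in\mathbb{YF}^3:\ n,m,l\geqslant 0,\ n=m+l\}$ is first-order definable in $\mathbf{YF}^*=\langle\mathbb{YF},\geqslant,2\rangle$.
   Context: $\mathbb{YF}$ is the set of all finite words (including the empty word $\varepsilon$) over $\{1,2\}$; $1^n$ denotes the word of $n$ ones. For a word $v$, $\#v$ is its length and $d(v)$ the number of letters $2$. Order: write $x=x'w$, $y=y'w$ with $w$ the longest common suffix; then $y\geqslant x$ iff $d(y')\geqslant\#x'$. $\mathbf{YF}^*$ is this partial order with an added constant symbol interpreted as the word $2$. A relation $R\subseteq\mathbb{YF}^k$ is first-order definable if there is a first-order formula $\phi(x_1,\dots,x_k)$ in the language $\{\geqslant,2\}$ whose set of satisfying tuples is exactly $R$. -}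

module Defs where

open import Data.Nat using (ℕ; zero; suc; _+_; _≤_)
open import Data.List using (List; []; _∷_; length; reverse; replicate)
open import Data.Vec using (Vec; lookup)
open import Data.Fin using (Fin)
open import Data.Product using (Σ; _×_; _,_; proj₁; proj₂; ∃-syntax)
open import Data.Empty using (⊥)
open import Relation.Nullary using (¬_)
open import Relation.Binary.PropositionalEquality using (_≡_)

data Letter : Set where
  one two : Letter

YF : Set
YF = List Letter

ones : ℕ → YF
ones n = replicate n one

d : YF → ℕ
d [] = 0
d (one ∷ v) = d v
d (two ∷ v) = suc (d v)

w2 : YF
w2 = two ∷ []

stripPrefix : YF → YF → YF × YF
stripPrefix (one ∷ a) (one ∷ b) = stripPrefix a b
stripPrefix (two ∷ a) (two ∷ b) = stripPrefix a b
stripPrefix a b = a , b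

-- y ≥ x : write x = x'w, y = y'w with w the longest common suffix;
-- then y ≥ x iff d(y') ≥ #x'.  (We strip the common prefix of the
-- reversed words; reversal does not affect length or d.)
_≥YF_ : YF → YF → Set
y ≥YF x = length (proj₁ p) ≤ d (proj₂ p)
  where
  p : YF × YF
  p = stripPrefix (reverse x) (reverse y)

data Term (n : ℕ) : Set where
  var : Fin n → Term n
  c2  : Term n

data Formula (n : ℕ) : Set where
  _≥'_ : Term n → Term n → Formula n
  _≐_  : Term n → Term n → Formula n
  ¬'_  : Formula n → Formula n
  _∧'_ : Formula n → Formula n → Formula n
  ∃'_  : Formula (suc n) → Formula n

evalT : ∀ {n} → Vec YF n → Term n → YF
evalT ρ (var i) = lookup ρ i
evalT ρ c2 = w2

-- Classical (Tarskian) satisfaction, rendered constructively via the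
-- Gödel–Gentzen negative translation: ∃ is interpreted as ¬¬Σ.
-- (All atoms are decidable, so this coincides with the classical semantics.)
Sat : ∀ {n} → Formula n → Vec YF n → Set
Sat (s ≥' t) ρ = evalT ρ s ≥YF evalT ρ t
Sat (s ≐ t) ρ = evalT ρ s ≡ evalT ρ t
Sat (¬' φ) ρ = ¬ Sat φ ρ
Sat (φ ∧' ψ) ρ = Sat φ ρ × Sat ψ ρ
Sat (∃' φ) ρ = ¬ ¬ (Σ YF λ w → Sat φ (w Data.Vec.∷ ρ))

R3 : YF → YF → YF → Set
R3 x y z = ∃[ n ] ∃[ m ] ∃[ l ] (x ≡ ones n × y ≡ ones m × z ≡ ones l × n ≡ m + l)

-- Write x ⊑ y for y ≥ x. The words 1^k form a chain, and 1^k ⊑ w iff k ≤ t + d(w), where t is the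
-- number of trailing ones of w; so the 1-words below a word, and the successor of a 1-word, are definable.
-- Given 1^n, 1^m, 1^l with m, l ≥ 1, the formula asks for X₁ = 1^c 2 1^l and X₂ = 1^c 2 1: each has a
-- single 2, X₁ has length n, X₂ has length m + 1, and their prefixes up to the 2 have equal length, which
-- forces n = (c + 1) + l = m + l. Lengths and prefixes are compared through "x lies below every common
-- upper bound of y and 1^k": testing against the words 2^a 1^b shows that for |x|, |y| ≤ k this holds iff
-- the prefix of x up to its last 2 is no longer than that of y, and for y = 1^i 2 and x ending in 1 and
-- containing a 2 it holds iff |x| ≤ k. The cases y = ε and z = ε are separate disjuncts.

module Submission where

open import Defs
open import Data.Nat using (ℕ; zero; suc; _+_; _∸_; _≤_; z≤n; s≤s; _≤?_; _≟_)
open import Data.Nat.Properties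
open import Data.List using ([]; _∷_; length; reverse; replicate; _++_; _∷ʳ_)
open import Data.List.Properties using (length-replicate; length-++; reverse-involutive; unfold-reverse; ≡-dec)
open import Data.Product using (Σ; _×_; _,_; proj₁; proj₂; ∃-syntax)
open import Data.Sum using (inj₁; inj₂)
open import Data.Fin using (Fin; zero; suc; #_)
open import Data.Vec using (Vec; lookup; _∷_; [])
open import Function.Base using (_∘_; id)
open import Function.Bundles using (_⇔_; mk⇔; Equivalence)
open import Relation.Nullary using (¬_; Dec; yes; no; Stable; contradiction)
open import Relation.Nullary.Decidable using (decidable-stable)
open import Relation.Binary.PropositionalEquality

open Equivalence using (to; from)

-- y ≥YF x is definitionally reverse x ⊑ reverse y; all words below are stored reversed,
-- so the common suffix of the order becomes a common prefix.
infix 4 _⊑_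

_⊑_ : YF → YF → Set
a ⊑ b = length (proj₁ (stripPrefix a b)) ≤ d (proj₂ (stripPrefix a b))

twos : ℕ → YF
twos n = replicate n two

leadingOnes : YF → ℕ
leadingOnes (one ∷ r) = suc (leadingOnes r)
leadingOnes (two ∷ r) = 0
leadingOnes [] = 0

onesBound : YF → ℕ
onesBound r = leadingOnes r + d r

tailLength : YF → ℕ
tailLength (one ∷ r) = tailLength r
tailLength (two ∷ r) = suc (length r)
tailLength [] = 0

d≤length : ∀ r → d r ≤ length r
d≤length [] = z≤n
d≤length (one ∷ r) = m≤n⇒m≤1+n (d≤length r)
d≤length (two ∷ r) = s≤s (d≤length r)

tailLength≤length : ∀ r → tailLength r ≤ length r
tailLength≤length [] = z≤n
tailLength≤length (one ∷ r) = m≤n⇒m≤1+n (tailLength≤length r)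
tailLength≤length (two ∷ r) = ≤-refl

d≡0⇒ones : ∀ r → d r ≡ 0 → r ≡ ones (length r)
d≡0⇒ones [] _ = refl
d≡0⇒ones (one ∷ r) e = cong (one ∷_) (d≡0⇒ones r e)

length-ones : ∀ k → length (ones k) ≡ k
length-ones k = length-replicate k

d-ones : ∀ k → d (ones k) ≡ 0
d-ones zero = refl
d-ones (suc k) = d-ones k

onesBound-ones : ∀ k → onesBound (ones k) ≡ k
onesBound-ones zero = refl
onesBound-ones (suc k) = cong suc (onesBound-ones k)

ones-injective : ∀ {j k} → ones j ≡ ones k → j ≡ k
ones-injective {j} {k} e = trans (sym (length-ones j)) (trans (cong length e) (length-ones k))

reverse-ones : ∀ k → reverse (ones k) ≡ ones k
reverse-ones zero = refl
reverse-ones (suc k) = begin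
  reverse (one ∷ ones k)  ≡⟨ unfold-reverse one (ones k) ⟩
  reverse (ones k) ∷ʳ one ≡⟨ cong (_∷ʳ one) (reverse-ones k) ⟩
  ones k ∷ʳ one           ≡⟨ ones-snoc k ⟩
  ones (suc k)            ∎
  where
  open ≡-Reasoning
  ones-snoc : ∀ k → ones k ∷ʳ one ≡ one ∷ ones k
  ones-snoc zero = refl
  ones-snoc (suc k) = cong (one ∷_) (ones-snoc k)

reverse≡ones⇒≡ones : ∀ w k → reverse w ≡ ones k → w ≡ ones k
reverse≡ones⇒≡ones w k e = begin
  w                 ≡⟨ sym (reverse-involutive w) ⟩
  reverse (reverse w) ≡⟨ cong reverse e ⟩
  reverse (ones k)  ≡⟨ reverse-ones k ⟩
  ones k            ∎
  where open ≡-Reasoning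

⊑⇒d≤ : ∀ a b → a ⊑ b → d a ≤ d b
⊑⇒d≤ [] b h = z≤n
⊑⇒d≤ (one ∷ a) (one ∷ b) h = ⊑⇒d≤ a b h
⊑⇒d≤ (two ∷ a) (two ∷ b) h = s≤s (⊑⇒d≤ a b h)
⊑⇒d≤ (one ∷ a) (two ∷ b) h = ≤-trans (d≤length a) (≤-trans (n≤1+n _) h)
⊑⇒d≤ (two ∷ a) (one ∷ b) h = ≤-trans (s≤s (d≤length a)) h

⊑⇒length≤ : ∀ a b → a ⊑ b → length a ≤ length b
⊑⇒length≤ [] b h = z≤n
⊑⇒length≤ (one ∷ a) (one ∷ b) h = s≤s (⊑⇒length≤ a b h)
⊑⇒length≤ (two ∷ a) (two ∷ b) h = s≤s (⊑⇒length≤ a b h)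
⊑⇒length≤ (one ∷ a) (two ∷ b) h = ≤-trans h (s≤s (d≤length b))
⊑⇒length≤ (two ∷ a) (one ∷ b) h = ≤-trans h (m≤n⇒m≤1+n (d≤length b))

length≤d⇒⊑ : ∀ a b → length a ≤ d b → a ⊑ b
length≤d⇒⊑ [] b h = z≤n
length≤d⇒⊑ (one ∷ a) (one ∷ b) h = length≤d⇒⊑ a b (≤-trans (n≤1+n _) h)
length≤d⇒⊑ (one ∷ a) (two ∷ b) h = h
length≤d⇒⊑ (two ∷ a) (one ∷ b) h = h
length≤d⇒⊑ (two ∷ a) (two ∷ b) h = length≤d⇒⊑ a b (≤-pred h)

⊑-trans : ∀ a b c → a ⊑ b → b ⊑ c → a ⊑ c
⊑-trans [] b c _ _ = z≤n
⊑-trans (one ∷ a) (one ∷ b) (one ∷ c) h k = ⊑-trans a b c h k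
⊑-trans (two ∷ a) (two ∷ b) (two ∷ c) h k = ⊑-trans a b c h k
⊑-trans (one ∷ a) (one ∷ b) (two ∷ c) h k = ≤-trans (s≤s (⊑⇒length≤ a b h)) k
⊑-trans (two ∷ a) (two ∷ b) (one ∷ c) h k = ≤-trans (s≤s (⊑⇒length≤ a b h)) k
⊑-trans (one ∷ a) (two ∷ b) c h k = length≤d⇒⊑ (one ∷ a) c (≤-trans h (⊑⇒d≤ (two ∷ b) c k))
⊑-trans (two ∷ a) (one ∷ b) c h k = length≤d⇒⊑ (two ∷ a) c (≤-trans h (⊑⇒d≤ (one ∷ b) c k))

≤onesBound⇒ones⊑ : ∀ k b → k ≤ onesBound b → ones k ⊑ b
≤onesBound⇒ones⊑ zero b _ = z≤n
≤onesBound⇒ones⊑ (suc k) (one ∷ b) h = ≤onesBound⇒ones⊑ k b (≤-pred h)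
≤onesBound⇒ones⊑ (suc k) (two ∷ b) h = subst (λ i → suc i ≤ suc (d b)) (sym (length-ones k)) h

ones⊑⇒≤onesBound : ∀ k b → ones k ⊑ b → k ≤ onesBound b
ones⊑⇒≤onesBound zero b _ = z≤n
ones⊑⇒≤onesBound (suc k) (one ∷ b) h = s≤s (ones⊑⇒≤onesBound k b h)
ones⊑⇒≤onesBound (suc k) (two ∷ b) h = subst (λ i → suc i ≤ suc (d b)) (length-ones k) h

ones⊑ones⇒≤ : ∀ j k → ones j ⊑ ones k → j ≤ k
ones⊑ones⇒≤ j k h = subst (j ≤_) (onesBound-ones k) (ones⊑⇒≤onesBound j (ones k) h)

≤⇒ones⊑ones : ∀ j k → j ≤ k → ones j ⊑ ones k
≤⇒ones⊑ones j k h = ≤onesBound⇒ones⊑ j (ones k) (subst (j ≤_) (sym (onesBound-ones k)) h)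

onesBound-reverse-ones : ∀ k → onesBound (reverse (ones k)) ≡ k
onesBound-reverse-ones k = trans (cong onesBound (reverse-ones k)) (onesBound-ones k)

ones⊑⇔ : ∀ k r → reverse (ones k) ⊑ r ⇔ k ≤ onesBound r
ones⊑⇔ k r = mk⇔ (ones⊑⇒≤onesBound k r ∘ subst (_⊑ r) (reverse-ones k))
                 (subst (_⊑ r) (sym (reverse-ones k)) ∘ ≤onesBound⇒ones⊑ k r)

⊑ones⇔ : ∀ j k → ones j ⊑ reverse (ones k) ⇔ j ≤ k
⊑ones⇔ j k = mk⇔ (ones⊑ones⇒≤ j k ∘ subst (ones j ⊑_) (reverse-ones k))
                 (subst (ones j ⊑_) (sym (reverse-ones k)) ∘ ≤⇒ones⊑ones j k)

-- Stairs and hooks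

stair : ℕ → ℕ → YF
stair b a = ones b ++ twos a

d-twos : ∀ a → d (twos a) ≡ a
d-twos zero = refl
d-twos (suc a) = cong suc (d-twos a)

d-stair : ∀ b a → d (stair b a) ≡ a
d-stair zero a = d-twos a
d-stair (suc b) a = d-stair b a

leadingOnes-stair : ∀ b a → leadingOnes (stair b a) ≡ b
leadingOnes-stair zero zero = refl
leadingOnes-stair zero (suc a) = refl
leadingOnes-stair (suc b) a = cong suc (leadingOnes-stair b a)

onesBound-stair : ∀ b a → onesBound (stair b a) ≡ b + a
onesBound-stair b a = cong₂ _+_ (leadingOnes-stair b a) (d-stair b a)

length-stair : ∀ b a → length (stair b a) ≡ b + a
length-stair b a = trans (length-++ (ones b)) (cong₂ _+_ (length-ones b) (length-replicate a))

stair⊑ : ∀ b a r → a ≤ d r → a + b ≤ onesBound r → stair b a ⊑ r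
stair⊑ zero a r h _ = length≤d⇒⊑ (twos a) r (subst (_≤ d r) (sym (length-replicate a)) h)
stair⊑ (suc b) a [] h k = contradiction (≤-trans (m≤n+m (suc b) a) k) λ ()
stair⊑ (suc b) a (one ∷ r) h k = stair⊑ b a r h (≤-pred (subst (_≤ suc (onesBound r)) (+-suc a b) k))
stair⊑ (suc b) a (two ∷ r) h k =
  subst (_≤ suc (d r)) (trans (+-suc a b) (cong suc (trans (+-comm a b) (sym (length-stair b a))))) k

⊑stair : ∀ b a x → tailLength x ≤ a → length x ≤ a + b → x ⊑ stair b a
⊑stair zero a x _ k = length≤d⇒⊑ x (twos a) (subst (length x ≤_) (trans (+-identityʳ a) (sym (d-twos a))) k)
⊑stair (suc b) a [] _ _ = z≤n
⊑stair (suc b) a (one ∷ x) h k = ⊑stair b a x h (≤-pred (subst (suc (length x) ≤_) (+-suc a b) k))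
⊑stair (suc b) a (two ∷ x) h k = subst (suc (length x) ≤_) (sym (d-stair b a)) h

⊑stair⇒tailLength≤ : ∀ b a x → x ⊑ stair b a → tailLength x ≤ a
⊑stair⇒tailLength≤ zero a x h =
  ≤-trans (tailLength≤length x) (subst (length x ≤_) (length-replicate a) (⊑⇒length≤ x (twos a) h))
⊑stair⇒tailLength≤ (suc b) a [] _ = z≤n
⊑stair⇒tailLength≤ (suc b) a (one ∷ x) h = ⊑stair⇒tailLength≤ b a x h
⊑stair⇒tailLength≤ (suc b) a (two ∷ x) h = subst (suc (length x) ≤_) (d-stair b a) h

tailLength≤d : ∀ x r → x ⊑ r → length x ≤ onesBound r → tailLength x ≤ d r
tailLength≤d [] r _ _ = z≤n
tailLength≤d (one ∷ x) (one ∷ r) h k = tailLength≤d x r h (≤-pred k)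
tailLength≤d (one ∷ x) (two ∷ r) h k = ≤-trans (tailLength≤length x) (≤-trans (n≤1+n _) h)
tailLength≤d (two ∷ x) (one ∷ r) h k = h
tailLength≤d (two ∷ x) (two ∷ r) h k = k

-- the reversal of 1^c 2 1^e
hook : ℕ → ℕ → YF
hook e c = ones e ++ two ∷ ones c

d-hook : ∀ e c → d (hook e c) ≡ 1
d-hook zero c = cong suc (d-ones c)
d-hook (suc e) c = d-hook e c

leadingOnes-hook : ∀ e c → leadingOnes (hook e c) ≡ e
leadingOnes-hook zero c = refl
leadingOnes-hook (suc e) c = cong suc (leadingOnes-hook e c)

onesBound-hook : ∀ e c → onesBound (hook e c) ≡ e + 1
onesBound-hook e c = cong₂ _+_ (leadingOnes-hook e c) (d-hook e c)

length-hook : ∀ e c → length (hook e c) ≡ e + suc c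
length-hook zero c = cong suc (length-ones c)
length-hook (suc e) c = cong suc (length-hook e c)

tailLength-hook : ∀ e c → tailLength (hook e c) ≡ suc c
tailLength-hook zero c = cong suc (length-ones c)
tailLength-hook (suc e) c = tailLength-hook e c

d≡1⇒hook : ∀ r → d r ≡ 1 → ∃[ e ] ∃[ c ] r ≡ hook e c
d≡1⇒hook (one ∷ r) h with d≡1⇒hook r h
... | e , c , refl = suc e , c , refl
d≡1⇒hook (two ∷ r) h = 0 , length r , cong (two ∷_) (d≡0⇒ones r (suc-injective h))

hook₀-classify : ∀ r → 1 ≤ d r → onesBound r ≤ 1 → ∃[ c ] r ≡ hook 0 c
hook₀-classify r d≥1 b≤1 with d≡1⇒hook r (≤-antisym (≤-trans (m≤n+m (d r) (leadingOnes r)) b≤1) d≥1)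
... | zero , c , refl = c , refl
... | suc e , c , refl =
  contradiction (m+n≤o⇒n≤o e (≤-pred (subst (_≤ 1) (onesBound-hook (suc e) c) b≤1))) λ ()

hook₊-classify : ∀ r → 1 ≤ d r → ¬ hook 0 1 ⊑ r → 2 ≤ onesBound r → ∃[ e ] ∃[ c ] r ≡ hook (suc e) c
hook₊-classify r d≥1 ¬21⊑r b≥2
  with d≡1⇒hook r (≤-antisym (≤-pred (≰⇒> (¬21⊑r ∘ length≤d⇒⊑ (hook 0 1) r))) d≥1)
... | zero , c , refl = contradiction (subst (2 ≤_) (onesBound-hook 0 c) b≥2) λ { (s≤s ()) }
... | suc e , c , refl = e , c , refl

hook₀⊑hook₊⇒≡0 : ∀ i e c → hook 0 i ⊑ hook (suc e) c → i ≡ 0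
hook₀⊑hook₊⇒≡0 i e c h =
  trans (sym (length-ones i)) (n≤0⇒n≡0 (≤-pred (subst (suc (length (ones i)) ≤_) (d-hook e c) h)))

-- Lying below every common upper bound

BelowBounds : YF → YF → YF → Set
BelowBounds y z x = ∀ r → y ⊑ r → z ⊑ r → x ⊑ r

BelowBounds-resp : ∀ {y y' z z' x x'} → y ≡ y' → z ≡ z' → x ≡ x' → BelowBounds y z x → BelowBounds y' z' x'
BelowBounds-resp refl refl refl bb = bb

-- Every common upper bound of y and 1^k lies above stair (k ∸ a) a for a = tailLength y,
-- and that stair lies above x.
tailLength≤⇒belowBounds : ∀ k y x → length y ≤ k → length x ≤ k → tailLength x ≤ tailLength y →
                          BelowBounds y (ones k) x
tailLength≤⇒belowBounds k y x y≤k x≤k tl r y⊑r k⊑r = ⊑-trans x (stair (k ∸ a) a) r x⊑s s⊑r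
  where
  a = tailLength y
  k≤b : k ≤ onesBound r
  k≤b = ones⊑⇒≤onesBound k r k⊑r
  k≡ : a + (k ∸ a) ≡ k
  k≡ = m+[n∸m]≡n (≤-trans (tailLength≤length y) y≤k)
  s⊑r : stair (k ∸ a) a ⊑ r
  s⊑r = stair⊑ (k ∸ a) a r (tailLength≤d y r y⊑r (≤-trans y≤k k≤b)) (subst (_≤ onesBound r) (sym k≡) k≤b)
  x⊑s : x ⊑ stair (k ∸ a) a
  x⊑s = ⊑stair (k ∸ a) a x tl (subst (length x ≤_) (sym k≡) x≤k)

belowBounds⇒tailLength≤ : ∀ k y x → BelowBounds y (ones k) x → tailLength x ≤ tailLength y
belowBounds⇒tailLength≤ k y x bb = ⊑stair⇒tailLength≤ b a x (bb (stair b a) y⊑s k⊑s)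
  where
  a = tailLength y
  b = k + length y
  y⊑s : y ⊑ stair b a
  y⊑s = ⊑stair b a y ≤-refl (≤-trans (m≤n+m (length y) k) (m≤n+m b a))
  k⊑s : ones k ⊑ stair b a
  k⊑s = ≤onesBound⇒ones⊑ k (stair b a)
          (subst (k ≤_) (sym (onesBound-stair b a)) (≤-trans (m≤m+n k (length y)) (m≤m+n b a)))

belowBounds⇒length≤pred : ∀ i k x → BelowBounds (hook 0 i) (ones k) (one ∷ x) → length x ≤ k ∸ 1
belowBounds⇒length≤pred i k x bb = ≤-pred (subst (suc (length x) ≤_) (cong suc (d-stair i (k ∸ 1))) x⊑r)
  where
  r = two ∷ stair i (k ∸ 1)
  k⊑r : ∀ k → ones k ⊑ two ∷ stair i (k ∸ 1)
  k⊑r zero = z≤n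
  k⊑r (suc k) = subst₂ (λ p q → suc p ≤ suc q) (sym (length-ones k)) (sym (d-stair i k)) ≤-refl
  x⊑r : one ∷ x ⊑ r
  x⊑r = bb r (≤onesBound⇒ones⊑ i _ (subst (i ≤_) (sym (onesBound-stair i (k ∸ 1))) (m≤m+n i _))) (k⊑r k)

belowBounds⇒length≤ : ∀ i k x → 1 ≤ d x → BelowBounds (hook 0 i) (ones k) (one ∷ x) → length (one ∷ x) ≤ k
belowBounds⇒length≤ i zero x d≥1 bb =
  contradiction (≤-trans (≤-trans d≥1 (d≤length x)) (belowBounds⇒length≤pred i 0 x bb)) λ ()
belowBounds⇒length≤ i (suc k) x _ bb = s≤s (belowBounds⇒length≤pred i (suc k) x bb)

length≤⇒belowBounds : ∀ k x → length (one ∷ x) ≤ k → BelowBounds (hook 0 (length x)) (ones k) (one ∷ x)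
length≤⇒belowBounds k x x≤k = tailLength≤⇒belowBounds k (hook 0 (length x)) (one ∷ x) h≤k x≤k tl
  where
  h≤k : length (hook 0 (length x)) ≤ k
  h≤k = subst (_≤ k) (sym (length-hook 0 (length x))) x≤k
  tl : tailLength x ≤ tailLength (hook 0 (length x))
  tl = subst (tailLength x ≤_) (sym (tailLength-hook 0 (length x))) (≤-trans (tailLength≤length x) (n≤1+n _))

private variable
  n : ℕ
  P : Set

_≟ℓ_ : (a b : Letter) → Dec (a ≡ b)
one ≟ℓ one = yes refl
two ≟ℓ two = yes refl
one ≟ℓ two = no λ ()
two ≟ℓ one = no λ ()

Sat-stable : ∀ (φ : Formula n) ρ → Stable (Sat φ ρ)
Sat-stable (s ≥' t) ρ = decidable-stable (_ ≤? _)
Sat-stable (s ≐ t) ρ = decidable-stable (≡-dec _≟ℓ_ _ _)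
Sat-stable (¬' φ) ρ ¬¬¬φ a = ¬¬¬φ λ ¬φ → ¬φ a
Sat-stable (φ ∧' ψ) ρ h =
  Sat-stable φ ρ (λ ¬φ → h (¬φ ∘ proj₁)) , Sat-stable ψ ρ (λ ¬ψ → h (¬ψ ∘ proj₂))
Sat-stable (∃' φ) ρ ¬¬∃ ¬Σ = ¬¬∃ λ ¬∃ → ¬∃ ¬Σ

infixr 6 _&_
infixr 5 _∨'_
infixr 4 _⇒'_
infix 20 ∀'_ ∀¹'_ ∃¹'_

-- _∧'_ with a fixity, so that conjunctions need no parentheses
_&_ : Formula n → Formula n → Formula n
_&_ = _∧'_

_⇒'_ : Formula n → Formula n → Formula n
φ ⇒' ψ = ¬' (φ ∧' (¬' ψ))

_∨'_ : Formula n → Formula n → Formula n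
φ ∨' ψ = ¬' ((¬' φ) ∧' (¬' ψ))

∀'_ : Formula (suc n) → Formula n
∀' φ = ¬' (∃' (¬' φ))

sat-∀ : ∀ (ρ : Vec YF n) (φ : Formula (suc n)) → Sat (∀' φ) ρ ⇔ (∀ w → Sat φ (w ∷ ρ))
sat-∀ ρ φ = mk⇔ (λ s w → Sat-stable φ (w ∷ ρ) λ ¬φ → s λ k → k (w , ¬φ))
                (λ h k → k λ (w , ¬φ) → ¬φ (h w))

sat-⇒ : ∀ (ρ : Vec YF n) (φ ψ : Formula n) → Sat (φ ⇒' ψ) ρ ⇔ (Sat φ ρ → Sat ψ ρ)
sat-⇒ ρ φ ψ = mk⇔ (λ s a → Sat-stable ψ ρ λ ¬b → s (a , ¬b)) (λ h (a , ¬b) → ¬b (h a))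

∨'-introˡ : ∀ (ρ : Vec YF n) (φ ψ : Formula n) → Sat φ ρ → Sat (φ ∨' ψ) ρ
∨'-introˡ ρ φ ψ a (¬a , _) = ¬a a

∨'-introʳ : ∀ (ρ : Vec YF n) (φ ψ : Formula n) → Sat ψ ρ → Sat (φ ∨' ψ) ρ
∨'-introʳ ρ φ ψ b (_ , ¬b) = ¬b b

∨'-elim : ∀ (ρ : Vec YF n) (φ ψ : Formula n) → Stable P →
          Sat (φ ∨' ψ) ρ → (Sat φ ρ → P) → (Sat ψ ρ → P) → P
∨'-elim ρ φ ψ stable s f g = stable λ ¬p → s ((¬p ∘ f) , (¬p ∘ g))

∃'-intro : ∀ (ρ : Vec YF n) (φ : Formula (suc n)) w → Sat φ (w ∷ ρ) → Sat (∃' φ) ρ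
∃'-intro ρ φ w a k = k (w , a)

∃'-elim : ∀ (ρ : Vec YF n) (φ : Formula (suc n)) → Stable P →
          Sat (∃' φ) ρ → (∀ w → Sat φ (w ∷ ρ) → P) → P
∃'-elim ρ φ stable s f = stable λ ¬p → s λ (w , a) → ¬p (f w a)

-- Sat (var i ≥' var j) ρ is definitionally ρ ‼ j ⊑ ρ ‼ i
_‼_ : Vec YF n → Fin n → YF
ρ ‼ i = reverse (lookup ρ i)

isOnes : Fin n → Formula n
isOnes i = ¬' (var i ≥' c2)

ones≱2 : ∀ k → ¬ ones k ≥YF w2
ones≱2 k h =
  contradiction (subst (1 ≤_) (trans (cong d (reverse-ones k)) (d-ones k)) (⊑⇒d≤ w2 (reverse (ones k)) h)) λ ()

≱2⇒ones : ∀ w → ¬ w ≥YF w2 → w ≡ ones (length (reverse w))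
≱2⇒ones w h =
  reverse≡ones⇒≡ones w _ (d≡0⇒ones (reverse w) (n<1⇒n≡0 (≰⇒> (h ∘ length≤d⇒⊑ w2 (reverse w)))))

∀¹'_ : Formula (suc n) → Formula n
∀¹' φ = ∀' (isOnes zero ⇒' φ)

∃¹'_ : Formula (suc n) → Formula n
∃¹' φ = ∃' (isOnes zero & φ)

sat-∀¹ : ∀ (ρ : Vec YF n) (φ : Formula (suc n)) → Sat (∀¹' φ) ρ ⇔ (∀ k → Sat φ (ones k ∷ ρ))
sat-∀¹ ρ φ = mk⇔
  (λ s k → to (sat-⇒ (ones k ∷ ρ) (isOnes zero) φ) (to (sat-∀ ρ (isOnes zero ⇒' φ)) s (ones k)) (ones≱2 k))
  (λ h → from (sat-∀ ρ (isOnes zero ⇒' φ)) λ w → from (sat-⇒ (w ∷ ρ) (isOnes zero) φ) λ o →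
     subst (λ u → Sat φ (u ∷ ρ)) (sym (≱2⇒ones w o)) (h _))

sat-∀¹⇒ : ∀ (ρ : Vec YF n) (φ ψ : Formula (suc n)) →
          Sat (∀¹' (φ ⇒' ψ)) ρ ⇔ (∀ k → Sat φ (ones k ∷ ρ) → Sat ψ (ones k ∷ ρ))
sat-∀¹⇒ ρ φ ψ = mk⇔
  (λ s k → to (sat-⇒ (ones k ∷ ρ) φ ψ) (to (sat-∀¹ ρ (φ ⇒' ψ)) s k))
  (λ h → from (sat-∀¹ ρ (φ ⇒' ψ)) λ k → from (sat-⇒ (ones k ∷ ρ) φ ψ) (h k))

∃¹'-intro : ∀ (ρ : Vec YF n) (φ : Formula (suc n)) k → Sat φ (ones k ∷ ρ) → Sat (∃¹' φ) ρ
∃¹'-intro ρ φ k a = ∃'-intro ρ (isOnes zero & φ) (ones k) (ones≱2 k , a)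

∃¹'-elim : ∀ (ρ : Vec YF n) (φ : Formula (suc n)) → Stable P →
           Sat (∃¹' φ) ρ → (∀ k → Sat φ (ones k ∷ ρ) → P) → P
∃¹'-elim ρ φ stable s f = ∃'-elim ρ (isOnes zero & φ) stable s λ w (o , a) →
  f _ (subst (λ u → Sat φ (u ∷ ρ)) (≱2⇒ones w o) a)

-- Definable relations

isEmpty : Fin n → Formula n
isEmpty i = ∀' (var zero ≥' var (suc i))

sat-isEmpty : ∀ (ρ : Vec YF n) i {k} → ρ ‼ i ≡ ones k → Sat (isEmpty i) ρ ⇔ k ≡ 0
sat-isEmpty ρ i {k} e = mk⇔
  (λ s → n≤0⇒n≡0 (ones⊑⇒≤onesBound k [] (subst (_⊑ []) e (to (sat-∀ ρ (var zero ≥' var (suc i))) s []))))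
  (λ { refl → from (sat-∀ ρ (var zero ≥' var (suc i))) λ w → subst (_⊑ reverse w) (sym e) z≤n })

aboveVar : Fin n → Formula (suc n)
aboveVar i = var zero ≥' var (suc i)

belowBounds : Fin n → Fin n → Fin n → Formula n
belowBounds y z x = ∀' (aboveVar y ⇒' aboveVar z ⇒' aboveVar x)

sat-belowBounds : ∀ (ρ : Vec YF n) y z x → Sat (belowBounds y z x) ρ ⇔ BelowBounds (ρ ‼ y) (ρ ‼ z) (ρ ‼ x)
sat-belowBounds ρ y z x = mk⇔ sound complete
  where
  φ = aboveVar z ⇒' aboveVar x
  sound : Sat (belowBounds y z x) ρ → BelowBounds (ρ ‼ y) (ρ ‼ z) (ρ ‼ x)
  sound s r y⊑r z⊑r = subst (ρ ‼ x ⊑_) (reverse-involutive r)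
    (to (sat-⇒ (reverse r ∷ ρ) (aboveVar z) (aboveVar x))
      (to (sat-⇒ (reverse r ∷ ρ) (aboveVar y) φ) (to (sat-∀ ρ (aboveVar y ⇒' φ)) s (reverse r))
        (unreverse (ρ ‼ y) y⊑r))
      (unreverse (ρ ‼ z) z⊑r))
    where
    unreverse : ∀ a → a ⊑ r → a ⊑ reverse (reverse r)
    unreverse a = subst (a ⊑_) (sym (reverse-involutive r))
  complete : BelowBounds (ρ ‼ y) (ρ ‼ z) (ρ ‼ x) → Sat (belowBounds y z x) ρ
  complete bb = from (sat-∀ ρ (aboveVar y ⇒' φ)) λ w → from (sat-⇒ (w ∷ ρ) (aboveVar y) φ) λ y⊑ →
    from (sat-⇒ (w ∷ ρ) (aboveVar z) (aboveVar x)) λ z⊑ → bb (reverse w) y⊑ z⊑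

belowNotUnderTwo : Fin n → Formula (suc n)
belowNotUnderTwo x = (¬' (c2 ≥' var zero)) & (var (suc x) ≥' var zero)

isHook₀ : Fin n → Formula n
isHook₀ p = (var p ≥' c2) & ¬' (∃¹' belowNotUnderTwo p)

sat-isHook₀ : ∀ (ρ : Vec YF n) p → Sat (isHook₀ p) ρ ⇔ (∃[ c ] ρ ‼ p ≡ hook 0 c)
sat-isHook₀ ρ p = mk⇔ sound complete
  where
  r = ρ ‼ p
  sound : Sat (isHook₀ p) ρ → ∃[ c ] r ≡ hook 0 c
  sound (2⊑r , ¬long) = hook₀-classify r (⊑⇒d≤ w2 r 2⊑r) (≤-pred (≰⇒> λ 2≤b → ¬long (long 2≤b)))
    where
    long : 2 ≤ onesBound r → Sat (∃¹' belowNotUnderTwo p) ρ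
    long 2≤b = ∃¹'-intro ρ (belowNotUnderTwo p) 2 ((λ { (s≤s ()) }) , ≤onesBound⇒ones⊑ 2 r 2≤b)
  complete : ∃[ c ] r ≡ hook 0 c → Sat (isHook₀ p) ρ
  complete (c , e) = subst (w2 ⊑_) (sym e) z≤n ,
    λ long → ∃¹'-elim ρ (belowNotUnderTwo p) (λ ¬¬⊥ → ¬¬⊥ id) long λ j (j⋢2 , j⊑r) →
      j⋢2 (from (ones⊑⇔ j w2) (subst (j ≤_) (trans (cong onesBound e) (onesBound-hook 0 c)) (to (ones⊑⇔ j r) j⊑r)))

isHook₊ : Fin n → Formula n
isHook₊ x = (var x ≥' c2) & ¬' (∃' (isHook₀ zero & belowNotUnderTwo x))

sat-isHook₊ : ∀ (ρ : Vec YF n) x → 2 ≤ onesBound (ρ ‼ x) →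
              Sat (isHook₊ x) ρ ⇔ (∃[ e ] ∃[ c ] ρ ‼ x ≡ hook (suc e) c)
sat-isHook₊ ρ x b≥2 = mk⇔ sound complete
  where
  r = ρ ‼ x
  sound : Sat (isHook₊ x) ρ → ∃[ e ] ∃[ c ] r ≡ hook (suc e) c
  sound (2⊑r , ¬long) = hook₊-classify r (⊑⇒d≤ w2 r 2⊑r) ¬21⊑r b≥2
    where
    ¬21⊑r : ¬ hook 0 1 ⊑ r
    ¬21⊑r h = ¬long (∃'-intro ρ (isHook₀ zero & belowNotUnderTwo x) (reverse (hook 0 1))
                (from (sat-isHook₀ (reverse (hook 0 1) ∷ ρ) zero) (1 , refl) , (λ ()) , h))
  complete : ∃[ e ] ∃[ c ] r ≡ hook (suc e) c → Sat (isHook₊ x) ρ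
  complete (e , c , eq) = subst (w2 ⊑_) (sym eq) (≤-reflexive (sym (d-hook e c))) ,
    λ long → ∃'-elim ρ (isHook₀ zero & belowNotUnderTwo x) (λ ¬¬⊥ → ¬¬⊥ id) long λ v (hv , v⋢2 , v⊑r) →
      let (i , ev) = to (sat-isHook₀ (v ∷ ρ) zero) hv
          i≡0 = hook₀⊑hook₊⇒≡0 i e c (subst₂ _⊑_ ev eq v⊑r)
      in v⋢2 (subst (_⊑ w2) (sym (trans ev (cong (hook 0) i≡0))) z≤n)

lengthAtMost : Fin n → Fin n → Formula n
lengthAtMost x k = ∃' (isHook₀ zero & belowBounds zero (suc k) (suc x))

sat-lengthAtMost : ∀ (ρ : Vec YF n) x k {x' q} → ρ ‼ x ≡ one ∷ x' → 1 ≤ d x' → ρ ‼ k ≡ ones q →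
                   Sat (lengthAtMost x k) ρ ⇔ length (one ∷ x') ≤ q
sat-lengthAtMost ρ x k {x'} {q} ex dx ek = mk⇔ sound complete
  where
  φ = isHook₀ zero & belowBounds zero (suc k) (suc x)
  sound : Sat (lengthAtMost x k) ρ → length (one ∷ x') ≤ q
  sound s = ∃'-elim ρ φ (decidable-stable (_ ≤? q)) s λ w (hw , bw) →
    let (i , ew) = to (sat-isHook₀ (w ∷ ρ) zero) hw
    in belowBounds⇒length≤ i q x' dx
         (BelowBounds-resp ew ek ex (to (sat-belowBounds (w ∷ ρ) zero (suc k) (suc x)) bw))
  complete : length (one ∷ x') ≤ q → Sat (lengthAtMost x k) ρ
  complete h = ∃'-intro ρ φ w
    ( from (sat-isHook₀ (w ∷ ρ) zero) (length x' , reverse-involutive (hook 0 (length x')))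
    , from (sat-belowBounds (w ∷ ρ) zero (suc k) (suc x))
        (BelowBounds-resp (sym (reverse-involutive (hook 0 (length x')))) (sym ek) (sym ex)
          (length≤⇒belowBounds q x' h)))
    where
    w = reverse (hook 0 (length x'))

lengthIs : Fin n → Fin n → Formula n
lengthIs x s = lengthAtMost x s & ∀¹' (lengthAtMost (suc x) zero ⇒' aboveVar s)

sat-lengthIs : ∀ (ρ : Vec YF n) x s {x' q} → ρ ‼ x ≡ one ∷ x' → 1 ≤ d x' → ρ ‼ s ≡ ones q →
               Sat (lengthIs x s) ρ ⇔ length (one ∷ x') ≡ q
sat-lengthIs ρ x s {x'} {q} ex dx es = mk⇔ sound complete
  where
  L = length (one ∷ x')
  atMost : ∀ j → Sat (lengthAtMost (suc x) zero) (ones j ∷ ρ) ⇔ L ≤ j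
  atMost j = sat-lengthAtMost (ones j ∷ ρ) (suc x) zero ex dx (reverse-ones j)
  sound : Sat (lengthIs x s) ρ → L ≡ q
  sound (L≤q , h) = ≤-antisym (to (sat-lengthAtMost ρ x s ex dx es) L≤q)
    (to (⊑ones⇔ q L) (subst (_⊑ reverse (ones L)) es
      (to (sat-∀¹⇒ ρ (lengthAtMost (suc x) zero) (aboveVar s)) h L (from (atMost L) ≤-refl))))
  complete : L ≡ q → Sat (lengthIs x s) ρ
  complete e = from (sat-lengthAtMost ρ x s ex dx es) (≤-reflexive e) ,
    from (sat-∀¹⇒ ρ (lengthAtMost (suc x) zero) (aboveVar s)) λ j a →
      subst (_⊑ reverse (ones j)) (sym es) (from (⊑ones⇔ q j) (subst (_≤ j) e (to (atMost j) a)))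

tailLengthLe : Fin n → Fin n → Formula n
tailLengthLe x y = ∃¹' belowBounds (suc y) zero (suc x)

sat-tailLengthLe : ∀ (ρ : Vec YF n) x y → Sat (tailLengthLe x y) ρ ⇔ tailLength (ρ ‼ x) ≤ tailLength (ρ ‼ y)
sat-tailLengthLe ρ x y = mk⇔ sound complete
  where
  φ = belowBounds (suc y) zero (suc x)
  sound : Sat (tailLengthLe x y) ρ → tailLength (ρ ‼ x) ≤ tailLength (ρ ‼ y)
  sound s = ∃¹'-elim ρ φ (decidable-stable (_ ≤? _)) s λ k b →
    belowBounds⇒tailLength≤ k (ρ ‼ y) (ρ ‼ x)
      (subst (λ o → BelowBounds (ρ ‼ y) o (ρ ‼ x)) (reverse-ones k)
        (to (sat-belowBounds (ones k ∷ ρ) (suc y) zero (suc x)) b))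
  complete : tailLength (ρ ‼ x) ≤ tailLength (ρ ‼ y) → Sat (tailLengthLe x y) ρ
  complete h = ∃¹'-intro ρ φ k (from (sat-belowBounds (ones k ∷ ρ) (suc y) zero (suc x))
    (subst (λ o → BelowBounds (ρ ‼ y) o (ρ ‼ x)) (sym (reverse-ones k))
      (tailLength≤⇒belowBounds k (ρ ‼ y) (ρ ‼ x) (m≤m+n _ _) (m≤n+m _ _) h)))
    where
    k = length (ρ ‼ y) + length (ρ ‼ x)

wk : Term n → Term (suc n)
wk (var i) = var (suc i)
wk c2 = c2

evalT-wk : ∀ (ρ : Vec YF n) w t → evalT (w ∷ ρ) (wk t) ≡ evalT ρ t
evalT-wk ρ w (var i) = refl
evalT-wk ρ w c2 = refl

succOf : Term n → Fin n → Formula n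
succOf t s = (¬' (t ≥' var s)) & ∀¹' ((var (suc s) ≥' var zero) ⇒' (wk t ≥' var zero) ∨' (var zero ≐ var (suc s)))

sat-succOf : ∀ (ρ : Vec YF n) t s {p q} → onesBound (reverse (evalT ρ t)) ≡ p → ρ ‼ s ≡ ones q →
             Sat (succOf t s) ρ ⇔ q ≡ suc p
sat-succOf ρ t s {p} {q} bt es = mk⇔ sound complete
  where
  rt = reverse (evalT ρ t)
  belowT = wk t ≥' var zero
  isS = var zero ≐ var (suc s)
  bs : onesBound (ρ ‼ s) ≡ q
  bs = trans (cong onesBound es) (onesBound-ones q)
  rt-wk : ∀ j → reverse (evalT (ones j ∷ ρ) (wk t)) ≡ rt
  rt-wk j = cong reverse (evalT-wk ρ (ones j) t)
  ones⊑t : ∀ j → Sat belowT (ones j ∷ ρ) ⇔ j ≤ p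
  ones⊑t j = mk⇔
    (λ h → subst (j ≤_) bt (to (ones⊑⇔ j rt) (subst (reverse (ones j) ⊑_) (rt-wk j) h)))
    (λ h → subst (reverse (ones j) ⊑_) (sym (rt-wk j)) (from (ones⊑⇔ j rt) (subst (j ≤_) (sym bt) h)))
  ones⊑s : ∀ j → Sat (var (suc s) ≥' var zero) (ones j ∷ ρ) → j ≤ q
  ones⊑s j h = subst (j ≤_) bs (to (ones⊑⇔ j (ρ ‼ s)) h)
  ones≡s : ∀ j → Sat isS (ones j ∷ ρ) ⇔ j ≡ q
  ones≡s j = mk⇔ (λ e → ones-injective (trans e ls)) (λ e → trans (cong ones e) (sym ls))
    where
    ls = reverse≡ones⇒≡ones (lookup ρ s) q es
  sound : Sat (succOf t s) ρ → q ≡ suc p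
  sound (t⋣s , h) = ∨'-elim (ones (suc p) ∷ ρ) belowT isS (decidable-stable (q ≟ suc p))
      (to (sat-∀¹⇒ ρ (var (suc s) ≥' var zero) (belowT ∨' isS)) h (suc p)
        (from (ones⊑⇔ (suc p) (ρ ‼ s)) (subst (suc p ≤_) (sym bs) p<q)))
      (λ below-t → contradiction (to (ones⊑t (suc p)) below-t) 1+n≰n)
      (λ at-s → sym (to (ones≡s (suc p)) at-s))
    where
    p<q : suc p ≤ q
    p<q = ≰⇒> λ q≤p → t⋣s (subst (_⊑ rt) (sym es) (≤onesBound⇒ones⊑ q rt (subst (q ≤_) (sym bt) q≤p)))
  complete : q ≡ suc p → Sat (succOf t s) ρ
  complete e = t⋣s , from (sat-∀¹⇒ ρ (var (suc s) ≥' var zero) (belowT ∨' isS)) λ j j⊑s →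
      below (subst (j ≤_) e (ones⊑s j j⊑s))
    where
    t⋣s : ¬ ρ ‼ s ⊑ rt
    t⋣s h = 1+n≰n (subst (_≤ p) e (subst (q ≤_) bt (ones⊑⇒≤onesBound q rt (subst (_⊑ rt) es h))))
    below : ∀ {j} → j ≤ suc p → Sat (belowT ∨' isS) (ones j ∷ ρ)
    below {j} j≤sp with m≤n⇒m<n∨m≡n j≤sp
    ... | inj₁ j<sp = ∨'-introˡ (ones j ∷ ρ) belowT isS (from (ones⊑t j) (≤-pred j<sp))
    ... | inj₂ j≡sp = ∨'-introʳ (ones j ∷ ρ) belowT isS (from (ones≡s j) (trans j≡sp (sym e)))

onesBoundIs : Fin n → Fin n → Formula n
onesBoundIs x s = (var x ≥' var s) & ∀¹' ((var (suc x) ≥' var zero) ⇒' (var (suc s) ≥' var zero))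

sat-onesBoundIs : ∀ (ρ : Vec YF n) x s {q} → ρ ‼ s ≡ ones q → Sat (onesBoundIs x s) ρ ⇔ onesBound (ρ ‼ x) ≡ q
sat-onesBoundIs ρ x s {q} es = mk⇔ sound complete
  where
  r = ρ ‼ x
  b = onesBound r
  bs : onesBound (ρ ‼ s) ≡ q
  bs = trans (cong onesBound es) (onesBound-ones q)
  sound : Sat (onesBoundIs x s) ρ → b ≡ q
  sound (s⊑r , h) = ≤-antisym
    (subst (b ≤_) bs (to (ones⊑⇔ b (ρ ‼ s))
      (to (sat-∀¹⇒ ρ (var (suc x) ≥' var zero) (var (suc s) ≥' var zero)) h b (from (ones⊑⇔ b r) ≤-refl))))
    (ones⊑⇒≤onesBound q r (subst (_⊑ r) es s⊑r))
  complete : b ≡ q → Sat (onesBoundIs x s) ρ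
  complete e = subst (_⊑ r) (sym es) (≤onesBound⇒ones⊑ q r (≤-reflexive (sym e))) ,
    from (sat-∀¹⇒ ρ (var (suc x) ≥' var zero) (var (suc s) ≥' var zero)) λ j j⊑r →
      from (ones⊑⇔ j (ρ ‼ s)) (subst (j ≤_) (trans e (sym bs)) (to (ones⊑⇔ j r) j⊑r))

-- variables, innermost first: s₃ s₂ s₁ X₂ X₁ x y z, where s₁ = 1^(l+1), s₂ = 1^2, s₃ = 1^(m+1)
sumWitness : Formula 8
sumWitness =
    isHook₊ (# 4) & isHook₊ (# 3)
  & succOf (var (# 7)) (# 2) & onesBoundIs (# 4) (# 2)
  & succOf c2 (# 1) & onesBoundIs (# 3) (# 1)
  & succOf (var (# 6)) (# 0) & lengthIs (# 3) (# 0)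
  & lengthIs (# 4) (# 5)
  & tailLengthLe (# 4) (# 3) & tailLengthLe (# 3) (# 4)

hooks⇒sum : ∀ {n m l} e₁ c₁ e₂ c₂ →
  onesBound (hook (suc e₁) c₁) ≡ suc l → length (hook (suc e₁) c₁) ≡ n →
  onesBound (hook (suc e₂) c₂) ≡ 2 → length (hook (suc e₂) c₂) ≡ suc m →
  tailLength (hook (suc e₁) c₁) ≡ tailLength (hook (suc e₂) c₂) → n ≡ m + l
hooks⇒sum {n} {m} {l} e₁ c₁ e₂ c₂ bound₁ length₁ bound₂ length₂ tails = begin
  n               ≡⟨ sym length₁ ⟩
  length (hook (suc e₁) c₁) ≡⟨ length-hook (suc e₁) c₁ ⟩
  suc e₁ + suc c₁ ≡⟨ cong₂ _+_ l≡ m≡ ⟩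
  l + m           ≡⟨ +-comm l m ⟩
  m + l           ∎
  where
  open ≡-Reasoning
  l≡ : suc e₁ ≡ l
  l≡ = suc-injective (trans (+-comm 1 (suc e₁)) (trans (sym (onesBound-hook (suc e₁) c₁)) bound₁))
  e₂≡0 : e₂ ≡ 0
  e₂≡0 = suc-injective (+-cancelʳ-≡ _ _ 1 (trans (sym (onesBound-hook (suc e₂) c₂)) bound₂))
  m≡ : suc c₁ ≡ m
  m≡ = begin
    suc c₁                        ≡⟨ sym (tailLength-hook (suc e₁) c₁) ⟩
    tailLength (hook (suc e₁) c₁) ≡⟨ tails ⟩
    tailLength (hook (suc e₂) c₂) ≡⟨ tailLength-hook (suc e₂) c₂ ⟩
    suc c₂                        ≡⟨ suc-injective (subst (λ e → suc e + suc c₂ ≡ suc m) e₂≡0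
                                       (trans (sym (length-hook (suc e₂) c₂)) length₂)) ⟩
    m                             ∎

sumWitness-sound : ∀ {n m l a₁ a₂ a₃} X₂ X₁ → 1 ≤ l →
  Sat sumWitness (ones a₃ ∷ ones a₂ ∷ ones a₁ ∷ X₂ ∷ X₁ ∷ ones n ∷ ones m ∷ ones l ∷ []) → n ≡ m + l
sumWitness-sound {n} {m} {l} {a₁} {a₂} {a₃} X₂ X₁ l≥1
  (hk₁ , hk₂ , sc₁ , ob₁ , sc₂ , ob₂ , sc₃ , len₂ , len₁ , tl₁₂ , tl₂₁) =
  shapes (to (sat-isHook₊ ρ (# 4) (subst (2 ≤_) (sym bound₁) (s≤s l≥1))) hk₁)
         (to (sat-isHook₊ ρ (# 3) (≤-reflexive (sym bound₂))) hk₂)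
  where
  ρ = ones a₃ ∷ ones a₂ ∷ ones a₁ ∷ X₂ ∷ X₁ ∷ ones n ∷ ones m ∷ ones l ∷ []
  bound₁ : onesBound (reverse X₁) ≡ suc l
  bound₁ = trans (to (sat-onesBoundIs ρ (# 4) (# 2) (reverse-ones a₁)) ob₁)
                 (to (sat-succOf ρ (var (# 7)) (# 2) (onesBound-reverse-ones l) (reverse-ones a₁)) sc₁)
  bound₂ : onesBound (reverse X₂) ≡ 2
  bound₂ = trans (to (sat-onesBoundIs ρ (# 3) (# 1) (reverse-ones a₂)) ob₂)
                 (to (sat-succOf ρ c2 (# 1) refl (reverse-ones a₂)) sc₂)
  tails : tailLength (reverse X₁) ≡ tailLength (reverse X₂)
  tails = ≤-antisym (to (sat-tailLengthLe ρ (# 4) (# 3)) tl₁₂) (to (sat-tailLengthLe ρ (# 3) (# 4)) tl₂₁)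
  shapes : (∃[ e ] ∃[ c ] reverse X₁ ≡ hook (suc e) c) → (∃[ e ] ∃[ c ] reverse X₂ ≡ hook (suc e) c) →
           n ≡ m + l
  shapes (e₁ , c₁ , eq₁) (e₂ , c₂ , eq₂) = hooks⇒sum e₁ c₁ e₂ c₂
    (subst (λ r → onesBound r ≡ suc l) eq₁ bound₁)
    (to (sat-lengthIs ρ (# 4) (# 5) eq₁ (≤-reflexive (sym (d-hook e₁ c₁))) (reverse-ones n)) len₁)
    (subst (λ r → onesBound r ≡ 2) eq₂ bound₂)
    (trans (to (sat-lengthIs ρ (# 3) (# 0) eq₂ (≤-reflexive (sym (d-hook e₂ c₂))) (reverse-ones a₃)) len₂)
           (to (sat-succOf ρ (var (# 6)) (# 0) (onesBound-reverse-ones m) (reverse-ones a₃)) sc₃))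
    (subst₂ (λ r r' → tailLength r ≡ tailLength r') eq₁ eq₂ tails)

-- for y = 1^(c+1) and z = 1^(l+1) the witnesses are X₁ = 1^c 2 1^(l+1) and X₂ = 1^c 2 1
sumWitness-complete : ∀ {n} l c → n ≡ suc c + suc l →
  Sat sumWitness (ones (suc (suc c)) ∷ ones 2 ∷ ones (suc (suc l)) ∷ reverse (hook 1 c) ∷ reverse (hook (suc l) c)
                   ∷ ones n ∷ ones (suc c) ∷ ones (suc l) ∷ [])
sumWitness-complete {n} l c n≡ =
    from (sat-isHook₊ ρ (# 4) (subst (2 ≤_) (sym bound₁) (s≤s (m≤n+m 1 l)))) (l , c , eq₁)
  , from (sat-isHook₊ ρ (# 3) (≤-reflexive (sym bound₂))) (0 , c , eq₂)
  , from (sat-succOf ρ (var (# 7)) (# 2) (onesBound-reverse-ones (suc l)) (reverse-ones _)) refl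
  , from (sat-onesBoundIs ρ (# 4) (# 2) (reverse-ones _)) (trans bound₁ (+-comm (suc l) 1))
  , from (sat-succOf ρ c2 (# 1) refl (reverse-ones 2)) refl
  , from (sat-onesBoundIs ρ (# 3) (# 1) (reverse-ones 2)) bound₂
  , from (sat-succOf ρ (var (# 6)) (# 0) (onesBound-reverse-ones (suc c)) (reverse-ones _)) refl
  , from (sat-lengthIs ρ (# 3) (# 0) eq₂ (≤-reflexive (sym (d-hook 0 c))) (reverse-ones _)) (length-hook 1 c)
  , from (sat-lengthIs ρ (# 4) (# 5) eq₁ (≤-reflexive (sym (d-hook l c))) (reverse-ones n))
      (trans (length-hook (suc l) c) (trans (+-comm (suc l) (suc c)) (sym n≡)))
  , from (sat-tailLengthLe ρ (# 4) (# 3)) (≤-reflexive tailLengths)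
  , from (sat-tailLengthLe ρ (# 3) (# 4)) (≤-reflexive (sym tailLengths))
  where
  ρ = ones (suc (suc c)) ∷ ones 2 ∷ ones (suc (suc l)) ∷ reverse (hook 1 c) ∷ reverse (hook (suc l) c)
        ∷ ones n ∷ ones (suc c) ∷ ones (suc l) ∷ []
  eq₁ : reverse (reverse (hook (suc l) c)) ≡ hook (suc l) c
  eq₁ = reverse-involutive (hook (suc l) c)
  eq₂ : reverse (reverse (hook 1 c)) ≡ hook 1 c
  eq₂ = reverse-involutive (hook 1 c)
  bound₁ : onesBound (reverse (reverse (hook (suc l) c))) ≡ suc l + 1
  bound₁ = trans (cong onesBound eq₁) (onesBound-hook (suc l) c)
  bound₂ : onesBound (reverse (reverse (hook 1 c))) ≡ 2
  bound₂ = trans (cong onesBound eq₂) (onesBound-hook 1 c)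
  tailLengths : tailLength (reverse (reverse (hook (suc l) c))) ≡ tailLength (reverse (reverse (hook 1 c)))
  tailLengths = trans (cong tailLength eq₁)
    (trans (tailLength-hook (suc l) c) (sym (trans (cong tailLength eq₂) (tailLength-hook 1 c))))

sum-y≡ε sum-z≡ε sum-z≢ε sumFormula : Formula 3
sum-y≡ε = isEmpty (# 1) & var (# 0) ≐ var (# 2)
sum-z≡ε = isEmpty (# 2) & var (# 0) ≐ var (# 1)
sum-z≢ε = ¬' isEmpty (# 2) & ∃' ∃' ∃¹' ∃¹' ∃¹' sumWitness
sumFormula = sum-y≡ε ∨' sum-z≡ε ∨' sum-z≢ε

sumFormula-sound : ∀ n m l → Sat sumFormula (ones n ∷ ones m ∷ ones l ∷ []) → n ≡ m + l
sumFormula-sound n m l s =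
  ∨'-elim ρ sum-y≡ε (sum-z≡ε ∨' sum-z≢ε) stable s y≡ε λ s' →
  ∨'-elim ρ sum-z≡ε sum-z≢ε stable s' z≡ε z≢ε
  where
  open ≡-Reasoning
  ρ = ones n ∷ ones m ∷ ones l ∷ []
  stable : Stable (n ≡ m + l)
  stable = decidable-stable (n ≟ m + l)
  y≡ε : Sat sum-y≡ε ρ → n ≡ m + l
  y≡ε (y-empty , x≡z) = begin
    n     ≡⟨ ones-injective x≡z ⟩
    l     ≡⟨ cong (_+ l) (sym (to (sat-isEmpty ρ (# 1) (reverse-ones m)) y-empty)) ⟩
    m + l ∎
  z≡ε : Sat sum-z≡ε ρ → n ≡ m + l
  z≡ε (z-empty , x≡y) = begin
    n     ≡⟨ ones-injective x≡y ⟩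
    m     ≡⟨ sym (+-identityʳ m) ⟩
    m + 0 ≡⟨ cong (m +_) (sym (to (sat-isEmpty ρ (# 2) (reverse-ones l)) z-empty)) ⟩
    m + l ∎
  z≢ε : Sat sum-z≢ε ρ → n ≡ m + l
  z≢ε (z-nonempty , w) =
    ∃'-elim ρ (∃' ∃¹' ∃¹' ∃¹' sumWitness) stable w λ X₁ w₁ →
    ∃'-elim (X₁ ∷ ρ) (∃¹' ∃¹' ∃¹' sumWitness) stable w₁ λ X₂ w₂ →
    ∃¹'-elim (X₂ ∷ X₁ ∷ ρ) (∃¹' ∃¹' sumWitness) stable w₂ λ a₁ w₃ →
    ∃¹'-elim (ones a₁ ∷ X₂ ∷ X₁ ∷ ρ) (∃¹' sumWitness) stable w₃ λ a₂ w₄ →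
    ∃¹'-elim (ones a₂ ∷ ones a₁ ∷ X₂ ∷ X₁ ∷ ρ) sumWitness stable w₄ λ _ →
    sumWitness-sound X₂ X₁ (n≢0⇒n>0 (z-nonempty ∘ from (sat-isEmpty ρ (# 2) (reverse-ones l))))

sumFormula-complete : ∀ n m l → n ≡ m + l → Sat sumFormula (ones n ∷ ones m ∷ ones l ∷ [])
sumFormula-complete n zero l n≡ =
  ∨'-introˡ ρ sum-y≡ε (sum-z≡ε ∨' sum-z≢ε)
    (from (sat-isEmpty ρ (# 1) (reverse-ones 0)) refl , cong ones n≡)
  where
  ρ = ones n ∷ ones 0 ∷ ones l ∷ []
sumFormula-complete n (suc c) zero n≡ =
  ∨'-introʳ ρ sum-y≡ε (sum-z≡ε ∨' sum-z≢ε) (∨'-introˡ ρ sum-z≡ε sum-z≢ε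
    (from (sat-isEmpty ρ (# 2) (reverse-ones 0)) refl , cong ones (trans n≡ (+-identityʳ _))))
  where
  ρ = ones n ∷ ones (suc c) ∷ ones 0 ∷ []
sumFormula-complete n (suc c) (suc l) n≡ =
  ∨'-introʳ ρ sum-y≡ε (sum-z≡ε ∨' sum-z≢ε) (∨'-introʳ ρ sum-z≡ε sum-z≢ε (z≢ε , witness))
  where
  ρ = ones n ∷ ones (suc c) ∷ ones (suc l) ∷ []
  X₁ = reverse (hook (suc l) c)
  X₂ = reverse (hook 1 c)
  z≢ε : ¬ Sat (isEmpty (# 2)) ρ
  z≢ε e with to (sat-isEmpty ρ (# 2) (reverse-ones (suc l))) e
  ... | ()
  witness : Sat (∃' ∃' ∃¹' ∃¹' ∃¹' sumWitness) ρ
  witness =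
    ∃'-intro ρ (∃' ∃¹' ∃¹' ∃¹' sumWitness) X₁ (∃'-intro (X₁ ∷ ρ) (∃¹' ∃¹' ∃¹' sumWitness) X₂
      (∃¹'-intro (X₂ ∷ X₁ ∷ ρ) (∃¹' ∃¹' sumWitness) (suc (suc l))
        (∃¹'-intro (ones (suc (suc l)) ∷ X₂ ∷ X₁ ∷ ρ) (∃¹' sumWitness) 2
          (∃¹'-intro (ones 2 ∷ ones (suc (suc l)) ∷ X₂ ∷ X₁ ∷ ρ) sumWitness (suc (suc c))
            (sumWitness-complete l c n≡)))))

sumOfOnes : Formula 3
sumOfOnes = isOnes (# 0) & isOnes (# 1) & isOnes (# 2) & sumFormula

mainTheorem6 : Σ (Formula 3) λ φ →
    ∀ (x y z : YF) → (Sat φ (x ∷ y ∷ z ∷ []) → R3 x y z) × (R3 x y z → Sat φ (x ∷ y ∷ z ∷ []))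
mainTheorem6 = sumOfOnes , λ x y z → sound x y z , complete x y z
  where
  sound : ∀ x y z → Sat sumOfOnes (x ∷ y ∷ z ∷ []) → R3 x y z
  sound x y z (x-ones , y-ones , z-ones , s) =
    _ , _ , _ , ex , ey , ez , sumFormula-sound _ _ _ (subst (Sat sumFormula) ρ≡ s)
    where
    ex = ≱2⇒ones x x-ones
    ey = ≱2⇒ones y y-ones
    ez = ≱2⇒ones z z-ones
    ρ≡ : x ∷ y ∷ z ∷ [] ≡ ones _ ∷ ones _ ∷ ones _ ∷ []
    ρ≡ = cong₂ _∷_ ex (cong₂ _∷_ ey (cong₂ _∷_ ez refl))
  complete : ∀ x y z → R3 x y z → Sat sumOfOnes (x ∷ y ∷ z ∷ [])
  complete _ _ _ (n , m , l , refl , refl , refl , n≡) = ones≱2 n , ones≱2 m , ones≱2 l , sumFormula-complete n m l n≡
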